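{- Let $k\ge 1$ and let $F$ be a graph with $\operatorname{tw}F\le k-1$ and $|V(F)|\ge k$. Then $F$ admits a tree decomposition $(T,\beta)$ such that (1) $|\beta(t)|=k$ for all $t\in V(T)$; (2) $|\beta(s)\cap\beta(t)|=k-1$ for all $st\in E(T)$; (3) there exists a vertex $r\in V(T)$ such that every vertex of the rooted tree $(T,r)$ has out-degree (number of children) at most $k$.
   Context: A tree decomposition of $F$ is a pair $(T,\beta)$ with $T$ a tree and $\beta\colon V(T)\to 2^{V(F)}$ such that the bags cover $V(F)$, every edge is contained in some bag, and for each vertex the set of nodes whose bags contain it is connected in $T$. Its width is $\max_t|\beta(t)|-1$; $\operatorname{tw}F$ is the minimum width. -}

module Defs where

open import Data.Nat using (ℕ; zero; suc; _≤_; _<_; _⊔_; _∸_)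
open import Data.Fin using (Fin)
open import Data.Fin.Subset using (Subset; _∈_; _∩_; ∣_∣)
open import Data.List using (List; []; _∷_; length; map; foldr; allFin)
open import Data.List.Relation.Unary.All using (All)
open import Data.List.Relation.Unary.Unique.Propositional using (Unique)
open import Data.Product using (Σ; ∃; ∃-syntax; _×_; _,_)
open import Data.Empty using (⊥)
open import Relation.Nullary using (¬_)
open import Relation.Binary.PropositionalEquality using (_≡_)
open import Function.Definitions using (Injective)

record Graph : Set₁ where
  field
    n     : ℕ
    Adj   : Fin n → Fin n → Set
    sym   : ∀ {u v} → Adj u v → Adj v u
    irrefl : ∀ {u} → ¬ Adj u u
open Graph public

V : Graph → Set
V G = Fin (n G)

data Walk (G : Graph) : V G → V G → Set where
  here : ∀ {u} → Walk G u u
  step : ∀ {u w v} → Adj G u w → Walk G w v → Walk G u v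

verts : ∀ {G u v} → Walk G u v → List (V G)
verts {u = u} here = u ∷ []
verts {u = u} (step _ p) = u ∷ verts p

IsPath : ∀ {G u v} → Walk G u v → Set
IsPath p = Unique (verts p)

Connected : Graph → Set
Connected G = ∀ (u v : V G) → Walk G u v

-- A cycle: an edge u w together with a path from w back to u having
-- at least 3 vertices (so the cycle has length ≥ 3).
HasCycle : Graph → Set
HasCycle G = Σ (V G) λ u → Σ (V G) λ w → Adj G u w ×
             Σ (Walk G w u) λ p → IsPath p × (3 ≤ length (verts p))

IsTree : Graph → Set
IsTree T = (0 < n T) × Connected T × ¬ HasCycle T

record TreeDecomposition (F : Graph) : Set₁ where
  field
    T      : Graph
    isTree : IsTree T
    β      : V T → Subset (n F)
    cover  : ∀ (v : V F) → ∃[ t ] (v ∈ β t)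
    edge   : ∀ (u v : V F) → Adj F u v → ∃[ t ] (u ∈ β t × v ∈ β t)
    -- for each vertex v, the nodes whose bags contain v induce a connected subtree
    coherent : ∀ (v : V F) (s t : V T) → v ∈ β s → v ∈ β t →
               Σ (Walk T s t) λ p → All (λ x → v ∈ β x) (verts p)
open TreeDecomposition public

maxOver : ∀ {m} → (Fin m → ℕ) → ℕ
maxOver {m} f = foldr _⊔_ 0 (map f (allFin m))

width : ∀ {F} → TreeDecomposition F → ℕ
width D = maxOver (λ t → ∣ β D t ∣) ∸ 1

-- tw F ≤ w  (the minimum width is ≤ w iff some decomposition has width ≤ w)
TwAtMost : Graph → ℕ → Set₁
TwAtMost F w = Σ (TreeDecomposition F) λ D → width D ≤ w

-- In the tree T rooted at r, s is a child of t: s is adjacent to t and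
-- the (unique) r–s path is an r–t path followed by the edge t s, i.e.
-- there is a path from r to t not containing s.
Child : (T : Graph) (r t s : V T) → Set
Child T r t s = Adj T t s × Σ (Walk T r t) λ p → IsPath p × ¬ (s ∈L verts p)
  where
  open import Data.List.Membership.Propositional renaming (_∈_ to _∈L_)

OutDegAtMost : (T : Graph) (r : V T) (k : ℕ) (t : V T) → Set
OutDegAtMost T r k t =
  ∀ (f : Fin (suc k) → V T) → Injective _≡_ _≡_ f → ¬ (∀ i → Child T r t (f i))

-- Root the given decomposition D and let top x be the node nearest the root whose bag contains
-- the vertex x.  Since the nodes containing x form a subtree hanging from top x, if x and w share
-- a bag and top x is not deeper than top w, then top w lies on the path from top x to that bag,
-- so x ∈ β (top w).  List the vertices by the depth of their tops.  The first k vertices form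
-- bag 0; the j-th later vertex v gets a bag consisting of v and k − 1 vertices of an earlier bag
-- chosen to contain the earlier vertices of β (top v): these are fewer than k, and by the fact
-- above they all lie in the bag of the latest of them.  Each new bag is attached to the last
-- earlier bag containing its k − 1 old vertices, which makes sizes and adjacent intersections
-- right, and two children of one bag miss different vertices of it, so there are at most k.

module Submission where

open import Defs
open import Data.Bool using (if_then_else_)
open import Data.Empty using (⊥; ⊥-elim)
open import Data.Fin using (Fin; toℕ; fromℕ<) renaming (zero to fzero; suc to fsuc)
open import Data.Fin.Induction using () renaming (<-wellFounded to <ᶠ-wellFounded)
open import Data.Fin.Properties using (any?; toℕ-injective; toℕ<n; toℕ-fromℕ<)
  renaming (_≟_ to _≟ᶠ_; suc-injective to fsuc-injective; 0≢1+n to 0≢ᶠ1+n)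
open import Data.Fin.Subset using (Subset; _∈_; _∉_; _⊆_; ∣_∣; _-_; _─_; _∩_; _∪_; ⁅_⁆; ∁; inside; outside)
  renaming (⊥ to ∅)
open import Data.Fin.Subset.Properties
  using (_∈?_; _⊆?_; x∈⁅x⁆; x∈⁅y⁆⇒x≡y; ∣⁅x⁆∣≡1; ∣p∣≤n; ∣p∣≤∣x∷p∣; ∣∁p∣≡n∸∣p∣; x∉p⇒x∈∁p;
         p⊆q⇒∣p∣≤∣q∣; p⊂q⇒∣p∣<∣q∣; p⊆p∪q; x∈p∪q⁺; x∈p∪q⁻; x∈p∩q⁺; x∈p∩q⁻; ∩-comm;
         p─q⊆p; x∈p∧x≢y⇒x∈p-y; x∈p⇒∣p-x∣<∣p∣)
open import Data.List using (List; []; _∷_; _++_; _∷ʳ_; length; reverse; filter; map; foldr; allFin; lookup;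
  initLast; _∷ʳ′_)
open import Data.List.Properties
  using (++-assoc; ∷-injective; ∷ʳ-injectiveʳ; ++-identityʳ; ++-cancelˡ; length-++; unfold-reverse; length-reverse;
         length-tabulate)
open import Data.List.Extrema.Nat using (argmin; argmin-all; f[argmin]≤f[xs]; argmax; argmax-all; f[xs]≤f[argmax])
open import Data.List.Membership.Propositional using () renaming (_∈_ to _∈ₗ_; _∉_ to _∉ₗ_)
open import Data.List.Membership.Propositional.Properties using (∈-++⁺ˡ; ∈-++⁺ʳ; ∈-++⁻; ∈-filter⁺; ∈-allFin; ∈-lookup)
open import Data.List.Membership.DecPropositional using () renaming (_∈?_ to ∈?-with)
open import Data.List.Relation.Unary.Any using (here; there; index)
open import Data.List.Relation.Unary.Any.Properties using (lookup-index)
open import Data.List.Relation.Unary.All as All using (All; []; _∷_)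
open import Data.List.Relation.Unary.All.Properties using (all-filter)
open import Data.List.Relation.Unary.AllPairs using ([]; _∷_)
open import Data.List.Relation.Unary.Unique.Propositional using (Unique)
import Data.List.Relation.Unary.Unique.Propositional.Properties as Unique
open import Data.List.Relation.Binary.Permutation.Propositional using (↭-sym; ↭⇒↭ₛ)
open import Data.List.Relation.Binary.Permutation.Propositional.Properties using (↭-reverse; ∈-resp-↭; ↭-length)
open import Data.List.Relation.Binary.Permutation.Setoid.Properties using (Unique-resp-↭)
import Data.List.Relation.Unary.Sorted.TotalOrder.Properties as Sorted
import Data.List.Sort as Sort
open import Data.Nat using (ℕ; zero; suc; _+_; _∸_; _⊔_; _≤_; _<_; z≤n; s≤s; _≟_; _≤?_; _<?_)
open import Data.Nat.Induction using (<-rec)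
open import Data.Nat.Properties
open import Data.Product using (Σ; ∃; ∃-syntax; _×_; _,_; proj₁; proj₂)
open import Data.Sum using (_⊎_; inj₁; inj₂; [_,_])
open import Data.Unit using (⊤; tt)
open import Data.Vec using (_∷_; []; tabulate) renaming (there to vthere)
open import Data.Vec.Properties using (lookup∘tabulate; lookup⇒[]=; []=⇒lookup)
import Induction.WellFounded as WF
open import Level using (0ℓ)
open import Relation.Nullary using (¬_; ¬?; Dec; yes; no; does)
open import Relation.Nullary.Decidable using (_×-dec_; dec-true)
open import Relation.Unary using (Decidable)
open import Relation.Binary.Bundles using (DecTotalOrder)
open import Relation.Binary.Definitions using (tri<; tri≈; tri>)
import Relation.Binary.Construct.On as On
open import Relation.Binary.PropositionalEquality
  using (_≡_; _≢_; refl; cong; subst; subst₂; trans; setoid; module ≡-Reasoning) renaming (sym to ≡-sym)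

module _ {A : Set} where

  Unique-++⁻ˡ : ∀ (xs : List A) {ys} → Unique (xs ++ ys) → Unique xs
  Unique-++⁻ˡ []       _          = []
  Unique-++⁻ˡ (x ∷ xs) (x∉ ∷ xs!) = All.tabulate (λ x∈ → All.lookup x∉ (∈-++⁺ˡ x∈)) ∷ Unique-++⁻ˡ xs xs!

  Unique-++⁻ʳ : ∀ (xs : List A) {ys} → Unique (xs ++ ys) → Unique ys
  Unique-++⁻ʳ []       ys!      = ys!
  Unique-++⁻ʳ (x ∷ xs) (_ ∷ u)  = Unique-++⁻ʳ xs u

  Unique-++⇒disjoint : ∀ (xs : List A) {ys z} → Unique (xs ++ ys) → z ∈ₗ xs → z ∉ₗ ys
  Unique-++⇒disjoint (x ∷ xs) (x∉ ∷ _) (here refl) z∈ys = All.lookup x∉ (∈-++⁺ʳ xs z∈ys) refl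
  Unique-++⇒disjoint (x ∷ xs) (_ ∷ u)  (there z∈xs) z∈ys = Unique-++⇒disjoint xs u z∈xs z∈ys

  Unique-reverse : ∀ {xs : List A} → Unique xs → Unique (reverse xs)
  Unique-reverse {xs} = Unique-resp-↭ (setoid A) (↭⇒↭ₛ (↭-sym (↭-reverse xs)))

  ++-shorter-prefix : ∀ (as bs : List A) {r r′} → as ++ r ≡ bs ++ r′ → length as ≤ length bs →
                      ∃ λ M → bs ≡ as ++ M
  ++-shorter-prefix []       bs       _  _         = bs , refl
  ++-shorter-prefix (a ∷ as) (b ∷ bs) eq (s≤s le) with ∷-injective eq
  ... | refl , eq′ with ++-shorter-prefix as bs eq′ le
  ...   | M , bs≡ = M , cong (a ∷_) bs≡

  last-∈-suffix : ∀ (as : List A) {M bs y} → as ++ M ≡ bs ∷ʳ y → M ≢ [] → y ∈ₗ M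
  last-∈-suffix as {M} {bs} eq M≢[] with initLast M
  ... | []      = ⊥-elim (M≢[] refl)
  ... | I ∷ʳ′ z = subst (_∈ₗ I ∷ʳ z)
      (∷ʳ-injectiveʳ (as ++ I) bs (trans (++-assoc as I (z ∷ [])) eq)) (∈-++⁺ʳ I (here refl))

≤foldr-⊔ : ∀ {B : Set} (f : B → ℕ) {xs x} → x ∈ₗ xs → f x ≤ foldr _⊔_ 0 (map f xs)
≤foldr-⊔ f {y ∷ _} (here refl) = m≤m⊔n (f y) _
≤foldr-⊔ f {y ∷ _} (there x∈) = m≤n⇒m≤o⊔n (f y) (≤foldr-⊔ f x∈)

lookup-injective : ∀ {A : Set} {xs : List A} → Unique xs → ∀ {i j} → lookup xs i ≡ lookup xs j → i ≡ j
lookup-injective {xs = _ ∷ _}  _          {fzero}  {fzero}  _ = refl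
lookup-injective {xs = _ ∷ xs} (x∉ ∷ _)   {fzero}  {fsuc j} e = ⊥-elim (All.lookup x∉ (∈-lookup j) e)
lookup-injective {xs = _ ∷ xs} (x∉ ∷ _)   {fsuc i} {fzero}  e = ⊥-elim (All.lookup x∉ (∈-lookup i) (≡-sym e))
lookup-injective {xs = _ ∷ xs} (_ ∷ xs!)  {fsuc i} {fsuc j} e = cong fsuc (lookup-injective xs! e)

argminOn : ∀ {N} (f : Fin N → ℕ) {P : Fin N → Set} → Decidable P → ∃ P →
           Σ (Fin N) λ x → P x × (∀ y → P y → f x ≤ f y)
argminOn {N} f P? (x₀ , px₀) =
  argmin f x₀ xs , argmin-all f px₀ (all-filter P? (allFin N)) ,
  λ y py → All.lookup (f[argmin]≤f[xs] x₀ xs) (∈-filter⁺ P? (∈-allFin y) py)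
  where xs = filter P? (allFin N)

argmaxOn : ∀ {N} (f : Fin N → ℕ) {P : Fin N → Set} → Decidable P → ∃ P →
           Σ (Fin N) λ x → P x × (∀ y → P y → f y ≤ f x)
argmaxOn {N} f P? (x₀ , px₀) =
  argmax f x₀ xs , argmax-all f px₀ (all-filter P? (allFin N)) ,
  λ y py → All.lookup (f[xs]≤f[argmax] x₀ xs) (∈-filter⁺ P? (∈-allFin y) py)
  where xs = filter P? (allFin N)

module Walks (G : Graph) where

  infixr 5 _++ʷ_
  _++ʷ_ : ∀ {u w v} → Walk G u w → Walk G w v → Walk G u v
  here     ++ʷ q = q
  step e p ++ʷ q = step e (p ++ʷ q)

  initVerts : ∀ {u v} → Walk G u v → List (V G)
  initVerts here           = []
  initVerts {u} (step _ p) = u ∷ initVerts p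

  verts≡initVerts∷ʳ : ∀ {u v} (p : Walk G u v) → verts p ≡ initVerts p ∷ʳ v
  verts≡initVerts∷ʳ here           = refl
  verts≡initVerts∷ʳ {u} (step _ p) = cong (u ∷_) (verts≡initVerts∷ʳ p)

  verts-++ʷ : ∀ {u w v} (p : Walk G u w) (q : Walk G w v) → verts (p ++ʷ q) ≡ initVerts p ++ verts q
  verts-++ʷ here           q = refl
  verts-++ʷ {u} (step _ p) q = cong (u ∷_) (verts-++ʷ p q)

  tailVerts : ∀ {u v} → Walk G u v → List (V G)
  tailVerts here       = []
  tailVerts (step _ p) = verts p

  verts≡∷tailVerts : ∀ {u v} (p : Walk G u v) → verts p ≡ u ∷ tailVerts p
  verts≡∷tailVerts here       = refl
  verts≡∷tailVerts (step _ p) = refl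

  tailVerts⊆verts : ∀ {u v x} (p : Walk G u v) → x ∈ₗ tailVerts p → x ∈ₗ verts p
  tailVerts⊆verts p x∈ = subst (_ ∈ₗ_) (≡-sym (verts≡∷tailVerts p)) (there x∈)

  verts-++ʷ-tail : ∀ {u w v} (p : Walk G u w) (q : Walk G w v) → verts (p ++ʷ q) ≡ verts p ++ tailVerts q
  verts-++ʷ-tail here           q = verts≡∷tailVerts q
  verts-++ʷ-tail {u} (step _ p) q = cong (u ∷_) (verts-++ʷ-tail p q)

  start∈ : ∀ {u v} (p : Walk G u v) → u ∈ₗ verts p
  start∈ here       = here refl
  start∈ (step _ p) = here refl

  initVerts⊆verts : ∀ {u v x} (p : Walk G u v) → x ∈ₗ initVerts p → x ∈ₗ verts p
  initVerts⊆verts p x∈ = subst (_ ∈ₗ_) (≡-sym (verts≡initVerts∷ʳ p)) (∈-++⁺ˡ x∈)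

  end∈ : ∀ {u v} (p : Walk G u v) → v ∈ₗ verts p
  end∈ p = subst (_ ∈ₗ_) (≡-sym (verts≡initVerts∷ʳ p)) (∈-++⁺ʳ (initVerts p) (here refl))

  ∈-++ʷ⁻ : ∀ {u w v x} (p : Walk G u w) (q : Walk G w v) →
           x ∈ₗ verts (p ++ʷ q) → x ∈ₗ verts p ⊎ x ∈ₗ verts q
  ∈-++ʷ⁻ p q x∈ with ∈-++⁻ (initVerts p) (subst (_ ∈ₗ_) (verts-++ʷ p q) x∈)
  ... | inj₁ x∈p = inj₁ (initVerts⊆verts p x∈p)
  ... | inj₂ x∈q = inj₂ x∈q

  2≤∣verts∣ : ∀ {u v} → u ≢ v → (p : Walk G u v) → 2 ≤ length (verts p)
  2≤∣verts∣ u≢u here            = ⊥-elim (u≢u refl)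
  2≤∣verts∣ _   (step _ here)     = s≤s (s≤s z≤n)
  2≤∣verts∣ _   (step _ (step _ _)) = s≤s (s≤s z≤n)

  no-closed-path : ∀ {a} (p : Walk G a a) → IsPath p → 2 ≤ length (verts p) → ⊥
  no-closed-path here       _        (s≤s ())
  no-closed-path (step _ p) (a∉ ∷ _) _ = All.lookup a∉ (end∈ p) refl

  verts-++ʷ-edge : ∀ {u w v} (p : Walk G u w) (e : Adj G w v) → verts (p ++ʷ step e here) ≡ verts p ∷ʳ v
  verts-++ʷ-edge {v = v} p e = begin
    verts (p ++ʷ step e here)      ≡⟨ verts-++ʷ p (step e here) ⟩
    initVerts p ++ _ ∷ v ∷ []      ≡⟨ ≡-sym (++-assoc (initVerts p) _ (v ∷ [])) ⟩
    (initVerts p ∷ʳ _) ∷ʳ v        ≡⟨ cong (_∷ʳ v) (≡-sym (verts≡initVerts∷ʳ p)) ⟩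
    verts p ∷ʳ v                   ∎
    where open ≡-Reasoning

  reverseʷ : ∀ {u v} → Walk G u v → Walk G v u
  reverseʷ here       = here
  reverseʷ (step e p) = reverseʷ p ++ʷ step (sym G e) here

  verts-reverseʷ : ∀ {u v} (p : Walk G u v) → verts (reverseʷ p) ≡ reverse (verts p)
  verts-reverseʷ here           = refl
  verts-reverseʷ {u} (step e p) = begin
    verts (reverseʷ p ++ʷ step (sym G e) here) ≡⟨ verts-++ʷ-edge (reverseʷ p) (sym G e) ⟩
    verts (reverseʷ p) ∷ʳ u                    ≡⟨ cong (_∷ʳ u) (verts-reverseʷ p) ⟩
    reverse (verts p) ∷ʳ u                     ≡⟨ ≡-sym (unfold-reverse u (verts p)) ⟩
    reverse (u ∷ verts p)                      ∎
    where open ≡-Reasoning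

  ∈-reverseʷ⁻ : ∀ {u v x} (p : Walk G u v) → x ∈ₗ verts (reverseʷ p) → x ∈ₗ verts p
  ∈-reverseʷ⁻ p x∈ = ∈-resp-↭ (↭-reverse (verts p)) (subst (_ ∈ₗ_) (verts-reverseʷ p) x∈)

  splitʷ : ∀ {u v x} (p : Walk G u v) → x ∈ₗ verts p →
           Σ (Walk G u x) λ a → Σ (Walk G x v) λ b → p ≡ a ++ʷ b
  splitʷ here       (here refl) = here , here , refl
  splitʷ (step e p) (here refl) = here , step e p , refl
  splitʷ (step e p) (there x∈) with splitʷ p x∈
  ... | a , b , refl = step e a , b , refl

  shortcut : ∀ {u v} (p : Walk G u v) →
             Σ (Walk G u v) λ q → IsPath q × (∀ {x} → x ∈ₗ verts q → x ∈ₗ verts p)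
  shortcut here = here , [] ∷ [] , λ x∈ → x∈
  shortcut {u} (step e p) with shortcut p
  ... | q , q! , q⊆p with ∈?-with _≟ᶠ_ u (verts q)
  ...   | yes u∈q with splitʷ q u∈q
  ...     | a , b , refl = b , Unique-++⁻ʳ (initVerts a) (subst Unique (verts-++ʷ a b) q!) ,
                           λ x∈b → there (q⊆p (subst (_ ∈ₗ_) (≡-sym (verts-++ʷ a b)) (∈-++⁺ʳ (initVerts a) x∈b)))
  shortcut {u} (step e p) | q , q! , q⊆p | no u∉q =
    step e q , All.tabulate (λ x∈q u≡x → u∉q (subst (_∈ₗ verts q) (≡-sym u≡x) x∈q)) ∷ q! ,
    λ { (here refl) → here refl ; (there x∈q) → there (q⊆p x∈q) }

module Acyclic (G : Graph) (acyclic : ¬ HasCycle G) where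
  open Walks G

  no-detour : ∀ {u a b} → Adj G u a → Adj G u b → a ≢ b →
              (w : Walk G a b) → u ∉ₗ verts w → ⊥
  no-detour {u} {a} {b} ua ub a≢b w u∉w with shortcut w
  ... | q , q! , q⊆w = acyclic (u , a , ua , q ++ʷ step bu here , cycle! , 3≤∣cycle∣)
    where
    bu = sym G ub
    cycle! : IsPath (q ++ʷ step bu here)
    cycle! = subst Unique (≡-sym (verts-++ʷ-edge q bu))
      (Unique.++⁺ q! ([] ∷ []) λ { (x∈q , here refl) → u∉w (q⊆w x∈q) })
    3≤∣cycle∣ : 3 ≤ length (verts (q ++ʷ step bu here))
    3≤∣cycle∣ rewrite verts-++ʷ-edge q bu | length-++ (verts q) {u ∷ []} | +-comm (length (verts q)) 1 =
      s≤s (2≤∣verts∣ a≢b q)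

  paths-unique : ∀ {u v} (p q : Walk G u v) → IsPath p → IsPath q → verts p ≡ verts q
  paths-unique here       here       _        _        = refl
  paths-unique here       (step _ q) _        (u∉ ∷ _) = ⊥-elim (All.lookup u∉ (end∈ q) refl)
  paths-unique (step _ p) here       (u∉ ∷ _) _        = ⊥-elim (All.lookup u∉ (end∈ p) refl)
  paths-unique {u} (step {w = a} ua p) (step {w = b} ub q) (u∉p ∷ p!) (u∉q ∷ q!) with a ≟ᶠ b
  ... | yes refl = cong (u ∷_) (paths-unique p q p! q!)
  ... | no a≢b   = ⊥-elim (no-detour ua ub a≢b (p ++ʷ reverseʷ q) u∉)
    where
    u∉ : u ∉ₗ verts (p ++ʷ reverseʷ q)
    u∉ u∈ with ∈-++ʷ⁻ p (reverseʷ q) u∈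
    ... | inj₁ u∈p = All.lookup u∉p u∈p refl
    ... | inj₂ u∈q = All.lookup u∉q (∈-reverseʷ⁻ q u∈q) refl

module RootedTree (T : Graph) (tree : IsTree T) where
  open Walks T
  open Acyclic T (proj₂ (proj₂ tree))

  root : V T
  root = fromℕ< (proj₁ tree)

  rootPath : ∀ t → Walk T root t
  rootPath t = proj₁ (shortcut (proj₁ (proj₂ tree) root t))

  rootPath! : ∀ t → IsPath (rootPath t)
  rootPath! t = proj₁ (proj₂ (shortcut (proj₁ (proj₂ tree) root t)))

  depth : V T → ℕ
  depth t = length (verts (rootPath t))

  rootPath-injective : ∀ {a b} → verts (rootPath a) ≡ verts (rootPath b) → a ≡ b
  rootPath-injective {a} {b} eq = ∷ʳ-injectiveʳ (initVerts (rootPath a)) (initVerts (rootPath b))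
    (trans (≡-sym (verts≡initVerts∷ʳ (rootPath a))) (trans eq (verts≡initVerts∷ʳ (rootPath b))))

  rootPath-prefix : ∀ {t z} → z ∈ₗ verts (rootPath t) →
                    ∃ λ rest → verts (rootPath t) ≡ verts (rootPath z) ++ rest
  rootPath-prefix {t} {z} z∈ with splitʷ (rootPath t) z∈
  ... | a , b , eq = tailVerts b , trans via (cong (_++ tailVerts b) (paths-unique a (rootPath z) a! (rootPath! z)))
    where
    via : verts (rootPath t) ≡ verts a ++ tailVerts b
    via = trans (cong verts eq) (verts-++ʷ-tail a b)
    a! : IsPath a
    a! = Unique-++⁻ˡ (verts a) (subst Unique via (rootPath! t))

  -- verts (rootPath i) ≡ verts (rootPath h) ++ rest says that h is an ancestor of i.
  holds-at-lower-ancestor :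
    ∀ (Q : V T → Set) {i hq hw rest rest′} →
    verts (rootPath i) ≡ verts (rootPath hq) ++ rest → All Q rest → Q hq →
    verts (rootPath i) ≡ verts (rootPath hw) ++ rest′ → depth hq ≤ depth hw → Q hw
  holds-at-lower-ancestor Q {hq = hq} {hw} {rest} {rest′} viaq Qrest Qhq viaw shallower
    with ++-shorter-prefix (verts (rootPath hq)) (verts (rootPath hw)) (trans (≡-sym viaq) viaw) shallower
  ... | [] , eq = subst Q (rootPath-injective (trans (≡-sym (++-identityʳ _)) (≡-sym eq))) Qhq
  ... | M@(_ ∷ _) , eq = All.lookup Qrest (subst (hw ∈ₗ_) (≡-sym rest≡) (∈-++⁺ˡ hw∈M))
    where
    hw∈M : hw ∈ₗ M
    hw∈M = last-∈-suffix (verts (rootPath hq)) (trans (≡-sym eq) (verts≡initVerts∷ʳ (rootPath hw))) (λ ())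
    rest≡ : rest ≡ M ++ rest′
    rest≡ = ++-cancelˡ (verts (rootPath hq)) rest (M ++ rest′)
      (trans (≡-sym viaq) (trans viaw (trans (cong (_++ rest′) eq) (++-assoc (verts (rootPath hq)) M rest′))))

  rootPath!ʳ : ∀ t → Unique (initVerts (rootPath t) ++ t ∷ [])
  rootPath!ʳ t = subst Unique (verts≡initVerts∷ʳ (rootPath t)) (rootPath! t)

  initVerts-shallower : ∀ {t z} → z ∈ₗ initVerts (rootPath t) → depth z < depth t
  initVerts-shallower {t} {z} z∈ with rootPath-prefix (initVerts⊆verts (rootPath t) z∈)
  ... | [] , eq = ⊥-elim (Unique-++⇒disjoint (initVerts (rootPath t)) (rootPath!ʳ t) z∈ (here z≡t))
    where
    z≡t : z ≡ t
    z≡t = rootPath-injective (trans (≡-sym (++-identityʳ _)) (≡-sym eq))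
  ... | r ∷ rs , eq rewrite eq | length-++ (verts (rootPath z)) {r ∷ rs} | +-suc (depth z) (length rs) =
    s≤s (m≤m+n (depth z) (length rs))

  module Top (Q : V T → Set) (Q? : Decidable Q) (nonempty : ∃ Q)
             (connected : ∀ s t → Q s → Q t → Σ (Walk T s t) λ p → All Q (verts p)) where

    private
      shallowest : Σ (V T) λ h → Q h × (∀ t → Q t → depth h ≤ depth t)
      shallowest = argminOn depth Q? nonempty

    top : V T
    top = proj₁ shallowest

    Q-top : Q top
    Q-top = proj₁ (proj₂ shallowest)

    rootPath-via-top : ∀ {i} → Q i → ∃ λ rest → verts (rootPath i) ≡ verts (rootPath top) ++ rest × All Q rest
    rootPath-via-top {i} Qi = tailVerts down , via , All.tabulate (λ x∈ → Q-down (tailVerts⊆verts down x∈))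
      where
      up = connected i top Qi Q-top
      down-path = shortcut (reverseʷ (proj₁ up))
      down = proj₁ down-path
      Q-down : ∀ {x} → x ∈ₗ verts down → Q x
      Q-down x∈ = All.lookup (proj₂ up) (∈-reverseʷ⁻ (proj₁ up) (proj₂ (proj₂ down-path) x∈))
      above-top : ∀ {x} → x ∈ₗ initVerts (rootPath top) → x ∉ₗ verts down
      above-top x∈ x∈down = 1+n≰n (≤-trans (initVerts-shallower x∈) (proj₂ (proj₂ shallowest) _ (Q-down x∈down)))
      path! : IsPath (rootPath top ++ʷ down)
      path! = subst Unique (≡-sym (verts-++ʷ (rootPath top) down))
        (Unique.++⁺ (Unique-++⁻ˡ (initVerts (rootPath top)) (rootPath!ʳ top)) (proj₁ (proj₂ down-path))
                    λ (x∈ , x∈down) → above-top x∈ x∈down)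
      via : verts (rootPath i) ≡ verts (rootPath top) ++ tailVerts down
      via = trans (paths-unique (rootPath i) (rootPath top ++ʷ down) (rootPath! i) path!)
                  (verts-++ʷ-tail (rootPath top) down)

module ParentTree (m : ℕ) (parent : Fin (suc m) → Fin (suc m))
                  (parent< : ∀ {t} → t ≢ fzero → toℕ (parent t) < toℕ t) where

  ParentEdge : Fin (suc m) → Fin (suc m) → Set
  ParentEdge s t = (t ≢ fzero × parent t ≡ s) ⊎ (s ≢ fzero × parent s ≡ t)

  tree : Graph
  tree = record
    { n      = suc m
    ; Adj    = ParentEdge
    ; sym    = λ { (inj₁ e) → inj₂ e ; (inj₂ e) → inj₁ e }
    ; irrefl = λ { (inj₁ (t≢0 , pt≡t)) → <-irrefl (cong toℕ pt≡t) (parent< t≢0)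
                 ; (inj₂ (t≢0 , pt≡t)) → <-irrefl (cong toℕ pt≡t) (parent< t≢0) }
    }

  open Walks tree

  walk-to : (Q : Fin (suc m) → Set) (g : Fin (suc m)) →
            (∀ {j} → Q j → j ≢ g → j ≢ fzero × Q (parent j)) →
            ∀ j → Q j → Σ (Walk tree j g) λ p → All Q (verts p)
  walk-to Q g up = WF.All.wfRec <ᶠ-wellFounded 0ℓ (λ j → Q j → Σ (Walk tree j g) λ p → All Q (verts p)) climb
    where
    climb : ∀ j → (∀ {i} → toℕ i < toℕ j → Q i → Σ (Walk tree i g) λ p → All Q (verts p)) →
            Q j → Σ (Walk tree j g) λ p → All Q (verts p)
    climb j rec Qj with j ≟ᶠ g
    ... | yes refl = here , Qj ∷ []
    ... | no j≢g with up Qj j≢g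
    ...   | j≢0 , Qpj with rec (parent< j≢0) Qpj
    ...     | p , Qp = step (inj₂ (j≢0 , refl)) p , Qj ∷ Qp

  upward-closed⇒connected : (Q : Fin (suc m) → Set) (g : Fin (suc m)) →
    (∀ {j} → Q j → j ≢ g → j ≢ fzero × Q (parent j)) →
    ∀ s t → Q s → Q t → Σ (Walk tree s t) λ p → All Q (verts p)
  upward-closed⇒connected Q g up s t Qs Qt with walk-to Q g up s Qs | walk-to Q g up t Qt
  ... | p , Qp | q , Qq = p ++ʷ reverseʷ q , All.tabulate λ x∈ →
    [ All.lookup Qp , (λ x∈q → All.lookup Qq (∈-reverseʷ⁻ q x∈q)) ] (∈-++ʷ⁻ p (reverseʷ q) x∈)

  descending : ∀ {a c b} → c ≢ fzero → parent c ≡ a → (p : Walk tree c b) →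
               Unique (a ∷ verts p) → toℕ a < toℕ b
  descending c≢0 refl here _ = parent< c≢0
  descending c≢0 refl (step (inj₁ (d≢0 , pd≡c)) p) (_ ∷ p!) =
    <-trans (parent< c≢0) (descending d≢0 pd≡c p p!)
  descending c≢0 refl (step (inj₂ (_ , pc≡d)) p) (a∉ ∷ _) =
    ⊥-elim (All.lookup a∉ (there (start∈ p)) pc≡d)

  no-cycle-below : ∀ {a b} → b ≢ fzero → parent b ≡ a → (p : Walk tree b a) →
                   IsPath p → 3 ≤ length (verts p) → ⊥
  no-cycle-below _ _ here _ (s≤s ())
  no-cycle-below b≢0 pb≡a (step (inj₁ (c≢0 , pc≡b)) p) p! _ =
    <-asym (descending c≢0 pc≡b p p!) (subst (λ z → toℕ z < _) pb≡a (parent< b≢0))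
  no-cycle-below b≢0 pb≡a (step (inj₂ (_ , pb≡c)) p) (_ ∷ p!) (s≤s 2≤) with trans (≡-sym pb≡c) pb≡a
  ... | refl = no-closed-path p p! 2≤

  acyclic : ¬ HasCycle tree
  acyclic (u , w , inj₁ (w≢0 , pw≡u) , p , p! , 3≤) = no-cycle-below w≢0 pw≡u p p! 3≤
  acyclic (u , w , inj₂ (u≢0 , pu≡w) , p , p! , 3≤) =
    no-cycle-below u≢0 pu≡w (reverseʷ p)
      (subst Unique (≡-sym (verts-reverseʷ p)) (Unique-reverse p!))
      (subst (3 ≤_) (trans (≡-sym (length-reverse (verts p))) (cong length (≡-sym (verts-reverseʷ p)))) 3≤)

  tree-isTree : IsTree tree
  tree-isTree = s≤s z≤n , connected , acyclic
    where
    connected : Connected tree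
    connected s t = proj₁ (upward-closed⇒connected (λ _ → ⊤) fzero (λ _ j≢0 → j≢0 , tt) s t tt tt)

  data Descendant (t : Fin (suc m)) : Fin (suc m) → Set where
    self  : Descendant t t
    child : ∀ {y} → y ≢ fzero → Descendant t (parent y) → Descendant t y

  descendant? : ∀ t → Decidable (Descendant t)
  descendant? t = WF.All.wfRec <ᶠ-wellFounded 0ℓ (λ y → Dec (Descendant t y)) decide
    where
    decide : ∀ y → (∀ {x} → toℕ x < toℕ y → Dec (Descendant t x)) → Dec (Descendant t y)
    decide y rec with y ≟ᶠ t
    ... | yes refl = yes self
    ... | no y≢t with y ≟ᶠ fzero
    ...   | yes refl = no λ { self → y≢t refl ; (child 0≢0 _) → 0≢0 refl }
    ...   | no y≢0 with rec (parent< y≢0)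
    ...     | yes d = yes (child y≢0 d)
    ...     | no ¬d = no λ { self → y≢t refl ; (child _ d) → ¬d d }

  enter-subtree-via-parent : ∀ {t x} (p : Walk tree x t) → ¬ Descendant t x → parent t ∈ₗ verts p
  enter-subtree-via-parent here ¬d = ⊥-elim (¬d self)
  enter-subtree-via-parent {t} (step {w = w} e p) ¬d with descendant? t w | e
  ... | no ¬dw | _ = there (enter-subtree-via-parent p ¬dw)
  ... | yes self        | inj₁ (_ , pt≡x) = here pt≡x
  ... | yes (child _ d) | inj₁ (_ , pw≡x) = ⊥-elim (¬d (subst (Descendant t) pw≡x d))
  ... | yes dw          | inj₂ (x≢0 , px≡w) = ⊥-elim (¬d (child x≢0 (subst (Descendant t) (≡-sym px≡w) dw)))

  child⇒parent : ∀ {t s} → Child tree fzero t s → s ≢ fzero × parent s ≡ t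
  child⇒parent (inj₁ s-below-t , _) = s-below-t
  child⇒parent {t} (inj₂ (t≢0 , pt≡s) , p , _ , s∉p) =
    ⊥-elim (s∉p (subst (_∈ₗ verts p) pt≡s (enter-subtree-via-parent p root-outside)))
    where
    root-outside : ¬ Descendant t fzero
    root-outside self          = t≢0 refl
    root-outside (child 0≢0 _) = 0≢0 refl

x∈p─q⇒x∉q : ∀ {N} (p q : Subset N) {x} → x ∈ p ─ q → x ∉ q
x∈p─q⇒x∉q (_ ∷ p)      (_ ∷ q)       (vthere x∈) (vthere x∈q) = x∈p─q⇒x∉q p q x∈ x∈q

∣p∪q∣≤∣p∣+∣q∣ : ∀ {N} (p q : Subset N) → ∣ p ∪ q ∣ ≤ ∣ p ∣ + ∣ q ∣
∣p∪q∣≤∣p∣+∣q∣ []            []            = z≤n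
∣p∪q∣≤∣p∣+∣q∣ (outside ∷ p) (outside ∷ q) = ∣p∪q∣≤∣p∣+∣q∣ p q
∣p∪q∣≤∣p∣+∣q∣ (outside ∷ p) (inside ∷ q)  =
  ≤-trans (s≤s (∣p∪q∣≤∣p∣+∣q∣ p q)) (≤-reflexive (≡-sym (+-suc ∣ p ∣ ∣ q ∣)))
∣p∪q∣≤∣p∣+∣q∣ (inside ∷ p)  (s ∷ q)       =
  s≤s (≤-trans (∣p∪q∣≤∣p∣+∣q∣ p q) (+-monoʳ-≤ ∣ p ∣ (∣p∣≤∣x∷p∣ s q)))

module _ {N : ℕ} where

  subset : {P : Fin N → Set} → Decidable P → Subset N
  subset P? = tabulate λ x → if does (P? x) then inside else outside

  ∈-subset⁺ : ∀ {P : Fin N → Set} (P? : Decidable P) {x} → P x → x ∈ subset P?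
  ∈-subset⁺ P? {x} Px = lookup⇒[]= x (subset P?) (trans (lookup∘tabulate _ x)
    (cong (if_then inside else outside) (dec-true (P? x) Px)))

  ∈-subset⁻ : ∀ {P : Fin N → Set} (P? : Decidable P) {x} → x ∈ subset P? → P x
  ∈-subset⁻ P? {x} x∈ with P? x | trans (≡-sym (lookup∘tabulate _ x)) ([]=⇒lookup x∈)
  ... | yes Px | _ = Px
  ... | no _   | ()

  x∈p-y⇒x≢y : ∀ {p : Subset N} {x y} → x ∈ p - y → x ≢ y
  x∈p-y⇒x≢y {p} {y = y} x∈ refl = x∈p─q⇒x∉q p ⁅ y ⁆ x∈ (x∈⁅x⁆ y)

  x∈p-y⇒x∈p : ∀ {p : Subset N} {x y} → x ∈ p - y → x ∈ p
  x∈p-y⇒x∈p {p} {y = y} = p─q⊆p p ⁅ y ⁆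

  x∉p⇒∣p∪⁅x⁆∣≡suc∣p∣ : ∀ {p : Subset N} {x} → x ∉ p → ∣ p ∪ ⁅ x ⁆ ∣ ≡ suc ∣ p ∣
  x∉p⇒∣p∪⁅x⁆∣≡suc∣p∣ {p} {x} x∉p = ≤-antisym
    (≤-trans (∣p∪q∣≤∣p∣+∣q∣ p ⁅ x ⁆) (≤-reflexive (trans (cong (∣ p ∣ +_) (∣⁅x⁆∣≡1 x)) (+-comm ∣ p ∣ 1))))
    (p⊂q⇒∣p∣<∣q∣ (p⊆p∪q ⁅ x ⁆ , x , x∈p∪q⁺ (inj₂ (x∈⁅x⁆ x)) , x∉p))

  x∈p⇒suc∣p-x∣≡∣p∣ : ∀ {p : Subset N} {x} → x ∈ p → suc ∣ p - x ∣ ≡ ∣ p ∣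
  x∈p⇒suc∣p-x∣≡∣p∣ {p} {x} x∈p = ≤-antisym (x∈p⇒∣p-x∣<∣p∣ x∈p) (begin
    ∣ p ∣                 ≤⟨ p⊆q⇒∣p∣≤∣q∣ p⊆[p-x]∪⁅x⁆ ⟩
    ∣ (p - x) ∪ ⁅ x ⁆ ∣   ≤⟨ ∣p∪q∣≤∣p∣+∣q∣ (p - x) ⁅ x ⁆ ⟩
    ∣ p - x ∣ + ∣ ⁅ x ⁆ ∣ ≡⟨ cong (∣ p - x ∣ +_) (∣⁅x⁆∣≡1 x) ⟩
    ∣ p - x ∣ + 1         ≡⟨ +-comm ∣ p - x ∣ 1 ⟩
    suc ∣ p - x ∣         ∎)
    where
    open ≤-Reasoning
    p⊆[p-x]∪⁅x⁆ : p ⊆ (p - x) ∪ ⁅ x ⁆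
    p⊆[p-x]∪⁅x⁆ {y} y∈p with y ≟ᶠ x
    ... | yes refl = x∈p∪q⁺ (inj₂ (x∈⁅x⁆ x))
    ... | no y≢x   = x∈p∪q⁺ (inj₁ (x∈p∧x≢y⇒x∈p-y y∈p y≢x))

  ⊆-by-size : ∀ {A B S : Subset N} {y} → A ⊆ S → y ∉ A → suc ∣ A ∣ ≡ ∣ S ∣ →
              B ⊆ S → y ∉ B → y ∈ S → B ⊆ A
  ⊆-by-size {A} {B} {S} {y} A⊆S y∉A ∣S∣ B⊆S y∉B y∈S {x} x∈B with x ∈? A
  ... | yes x∈A = x∈A
  ... | no x∉A  = ⊥-elim (<-irrefl refl (begin-strict
    suc ∣ A ∣ ≤⟨ p⊂q⇒∣p∣<∣q∣ (avoid A⊆S y∉A , x , avoid B⊆S y∉B x∈B , x∉A) ⟩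
    ∣ S - y ∣ <⟨ x∈p⇒∣p-x∣<∣p∣ y∈S ⟩
    ∣ S ∣     ≡⟨ ≡-sym ∣S∣ ⟩
    suc ∣ A ∣ ∎))
    where
    open ≤-Reasoning
    avoid : ∀ {C} → C ⊆ S → y ∉ C → C ⊆ S - y
    avoid C⊆S y∉C z∈C = x∈p∧x≢y⇒x∈p-y (C⊆S z∈C) λ { refl → y∉C z∈C }

  injection⇒≤∣_∣ : ∀ (S : Subset N) {M} (f : Fin M → Fin N) → (∀ {i j} → f i ≡ f j → i ≡ j) →
                   (∀ i → f i ∈ S) → M ≤ ∣ S ∣
  injection⇒≤∣ S ∣ {zero}  f f-inj f∈S = z≤n
  injection⇒≤∣ S ∣ {suc M} f f-inj f∈S = begin
    suc M               ≤⟨ s≤s (injection⇒≤∣ S - f fzero ∣ (λ i → f (fsuc i)) (λ e → fsuc-injective (f-inj e))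
                              λ i → x∈p∧x≢y⇒x∈p-y (f∈S (fsuc i)) λ e → 0≢ᶠ1+n (≡-sym (f-inj e))) ⟩
    suc ∣ S - f fzero ∣ ≡⟨ x∈p⇒suc∣p-x∣≡∣p∣ (f∈S fzero) ⟩
    ∣ S ∣               ∎
    where open ≤-Reasoning

  pick : Fin N → Subset N → Subset N → Fin N
  pick default S A with any? (λ y → (y ∈? S) ×-dec ¬? (y ∈? A))
  ... | yes (y , _) = y
  ... | no _        = default

  pick∈∖ : ∀ default {S A : Subset N} → ∣ A ∣ < ∣ S ∣ → pick default S A ∈ S × pick default S A ∉ A
  pick∈∖ default {S} {A} ∣A∣<∣S∣ with any? (λ y → (y ∈? S) ×-dec ¬? (y ∈? A))
  ... | yes (_ , y∈S∖A) = y∈S∖A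
  ... | no ∄y = ⊥-elim (<⇒≱ ∣A∣<∣S∣ (p⊆q⇒∣p∣≤∣q∣ S⊆A))
    where
    S⊆A : S ⊆ A
    S⊆A {x} x∈S with x ∈? A
    ... | yes x∈A = x∈A
    ... | no x∉A  = ⊥-elim (∄y (x , x∈S , x∉A))

module LastBelow {Q : ℕ → Set} (Q? : Decidable Q) where

  lastBelow : ℕ → ℕ
  lastBelow zero = zero
  lastBelow (suc j) with Q? j
  ... | yes _ = j
  ... | no _  = lastBelow j

  lastBelow≤ : ∀ j → lastBelow j ≤ j
  lastBelow≤ zero = z≤n
  lastBelow≤ (suc j) with Q? j
  ... | yes _ = n≤1+n j
  ... | no _  = m≤n⇒m≤1+n (lastBelow≤ j)

  lastBelow-suc< : ∀ j → lastBelow (suc j) < suc j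
  lastBelow-suc< j with Q? j
  ... | yes _ = ≤-refl
  ... | no _  = s≤s (lastBelow≤ j)

  lastBelow-satisfies : ∀ {j i} → i < j → Q i → Q (lastBelow j)
  lastBelow-satisfies {suc j} {i} (s≤s i≤j) Qi with Q? j
  ... | yes Qj = Qj
  ... | no ¬Qj with i ≟ j
  ...   | yes refl = ⊥-elim (¬Qj Qi)
  ...   | no i≢j   = lastBelow-satisfies (≤∧≢⇒< i≤j i≢j) Qi

  lastBelow-maximal : ∀ {j i} → i < j → Q i → i ≤ lastBelow j
  lastBelow-maximal {suc j} {i} (s≤s i≤j) Qi with Q? j
  ... | yes _ = i≤j
  ... | no ¬Qj with i ≟ j
  ...   | yes refl = ⊥-elim (¬Qj Qi)
  ...   | no i≢j   = lastBelow-maximal (≤∧≢⇒< i≤j i≢j) Qi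

module Construction (k′ : ℕ) (F : Graph) (D : TreeDecomposition F)
                    (width≤ : width D ≤ k′) (k≤n : suc k′ ≤ n F) where

  k : ℕ
  k = suc k′

  ∣β∣≤k : ∀ t → ∣ β D t ∣ ≤ k
  ∣β∣≤k t = ≤-trans (m≤n+m∸n ∣ β D t ∣ 1)
    (s≤s (≤-trans (∸-monoˡ-≤ 1 (≤foldr-⊔ (λ t → ∣ β D t ∣) (∈-allFin t))) width≤))

  open RootedTree (T D) (isTree D)

  module VertexTop (x : V F) = Top (λ t → x ∈ β D t) (λ t → x ∈? β D t) (cover D x) (coherent D x)

  top : V F → V (T D)
  top = VertexTop.top

  topDepth : V F → ℕ
  topDepth x = depth (top x)

  ∈-top-of-deeper : ∀ {x w t} → x ∈ β D t → w ∈ β D t → topDepth x ≤ topDepth w → x ∈ β D (top w)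
  ∈-top-of-deeper {x} {w} {t} x∈ w∈ shallower =
    holds-at-lower-ancestor (λ t → x ∈ β D t) {i = t} {hq = top x} {hw = top w}
      {rest = proj₁ via-x} {rest′ = proj₁ via-w}
      (proj₁ (proj₂ via-x)) (proj₂ (proj₂ via-x)) (VertexTop.Q-top x) (proj₁ (proj₂ via-w)) shallower
    where
    via-x = VertexTop.rootPath-via-top x x∈
    via-w = VertexTop.rootPath-via-top w w∈

  open Sort (On.decTotalOrder ≤-decTotalOrder topDepth) using (sort; sort-↭; sort-↗)

  opaque
    order : List (V F)
    order = sort (allFin (n F))

    N≡n : length order ≡ n F
    N≡n = trans (↭-length (sort-↭ (allFin (n F)))) (length-tabulate (λ x → x))

    ∈-order : ∀ x → x ∈ₗ order
    ∈-order x = ∈-resp-↭ (↭-sym (sort-↭ (allFin (n F)))) (∈-allFin x)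

    order! : Unique order
    order! = Unique-resp-↭ (setoid (V F)) (↭⇒↭ₛ (↭-sym (sort-↭ (allFin (n F))))) (Unique.allFin⁺ (n F))

    order-sorted : ∀ {i j : Fin (length order)} → toℕ i ≤ toℕ j →
                   topDepth (lookup order i) ≤ topDepth (lookup order j)
    order-sorted = Sorted.lookup-mono-≤ (DecTotalOrder.totalOrder (On.decTotalOrder ≤-decTotalOrder topDepth))
                                        (sort-↗ (allFin (n F)))

  N : ℕ
  N = length order

  rank : V F → ℕ
  rank x = toℕ (index (∈-order x))

  rank<N : ∀ x → rank x < N
  rank<N x = toℕ<n (index (∈-order x))

  rank-lookup : ∀ (i : Fin N) → rank (lookup order i) ≡ toℕ i
  rank-lookup i = cong toℕ (lookup-injective order! (≡-sym (lookup-index (∈-order (lookup order i)))))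

  rank-injective : ∀ {x w} → rank x ≡ rank w → x ≡ w
  rank-injective {x} {w} e = trans (lookup-index (∈-order x))
    (trans (cong (lookup order) (toℕ-injective e)) (≡-sym (lookup-index (∈-order w))))

  topDepth-monotone : ∀ {x w} → rank x ≤ rank w → topDepth x ≤ topDepth w
  topDepth-monotone {x} {w} x≤w = subst₂ (λ a b → topDepth a ≤ topDepth b)
    (≡-sym (lookup-index (∈-order x))) (≡-sym (lookup-index (∈-order w))) (order-sorted x≤w)

  default : V F
  default = fromℕ< (≤-trans (s≤s z≤n) k≤n)

  opaque
    vertexAt : ℕ → V F
    vertexAt p with p <? N
    ... | yes p<N = lookup order (fromℕ< p<N)
    ... | no  _   = default

    rank-vertexAt : ∀ {p} → p < N → rank (vertexAt p) ≡ p
    rank-vertexAt {p} p<N with p <? N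
    ... | yes p<N′ = trans (rank-lookup (fromℕ< p<N′)) (toℕ-fromℕ< p<N′)
    ... | no  p≮N  = ⊥-elim (p≮N p<N)

  vertexAt-rank : ∀ x → vertexAt (rank x) ≡ x
  vertexAt-rank x = rank-injective (rank-vertexAt (rank<N x))

  m : ℕ
  m = N ∸ k

  k+m≡N : k + m ≡ N
  k+m≡N = m+[n∸m]≡n (subst (k ≤_) (≡-sym N≡n) k≤n)

  new : ℕ → V F
  new j = vertexAt (k′ + j)

  rank-new : ∀ {j} → j ≤ m → rank (new j) ≡ k′ + j
  rank-new {j} j≤m = rank-vertexAt (subst (k′ + j <_) k+m≡N (s≤s (+-monoʳ-≤ k′ j≤m)))

  opaque
    initial : Subset (n F)
    initial = subset (λ x → rank x ≤? k′)

    ∈initial⁺ : ∀ {x} → rank x ≤ k′ → x ∈ initial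
    ∈initial⁺ = ∈-subset⁺ (λ x → rank x ≤? k′)

    ∈initial⁻ : ∀ {x} → x ∈ initial → rank x ≤ k′
    ∈initial⁻ = ∈-subset⁻ (λ x → rank x ≤? k′)

    back : ℕ → Subset (n F)
    back j = subset (λ x → (x ∈? β D (top (new j))) ×-dec (rank x <? k′ + j))

    ∈back⁺ : ∀ {j x} → x ∈ β D (top (new j)) → rank x < k′ + j → x ∈ back j
    ∈back⁺ {j} x∈ r< = ∈-subset⁺ (λ x → (x ∈? β D (top (new j))) ×-dec (rank x <? k′ + j)) (x∈ , r<)

    ∈back⁻ : ∀ {j x} → x ∈ back j → x ∈ β D (top (new j)) × rank x < k′ + j
    ∈back⁻ {j} = ∈-subset⁻ (λ x → (x ∈? β D (top (new j))) ×-dec (rank x <? k′ + j))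

  Bags : Set
  Bags = ℕ → Subset (n F)

  opaque
    hostIn : ℕ → Bags → ℕ
    hostIn j bags = LastBelow.lastBelow (λ i → back j ⊆? bags i) j

    keepIn : ℕ → Bags → Subset (n F)
    keepIn j bags = bags (hostIn j bags) - pick default (bags (hostIn j bags)) (back j)

    nextBag : ℕ → Bags → Subset (n F)
    nextBag zero    _    = initial
    nextBag (suc j) bags = keepIn (suc j) bags ∪ ⁅ new (suc j) ⁆

    -- earlier j lists the bags 0, …, j − 1 (it is junk beyond), so that bag j may depend on all of them.
    earlier : ℕ → Bags
    earlier zero    _ = ∅
    earlier (suc j) i with i <? j
    ... | yes _ = earlier j i
    ... | no  _ = nextBag j (earlier j)

    bag : ℕ → Subset (n F)
    bag j = nextBag j (earlier j)

    earlier≡bag : ∀ {j i} → i < j → earlier j i ≡ bag i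
    earlier≡bag {suc j} {i} (s≤s i≤j) with i <? j
    ... | yes i<j = earlier≡bag i<j
    ... | no  i≮j = cong bag (≡-sym (≤-antisym i≤j (≮⇒≥ i≮j)))

    bag-zero : bag 0 ≡ initial
    bag-zero = refl

  opaque
    unfolding bag

    module HostSearch (j : ℕ) = LastBelow (λ i → back j ⊆? earlier j i)

    host : ℕ → ℕ
    host j = hostIn j (earlier j)

    kept : ℕ → Subset (n F)
    kept j = keepIn j (earlier j)

    module ParentSearch (j : ℕ) = LastBelow (λ i → kept j ⊆? earlier j i)

    parent : ℕ → ℕ
    parent j = ParentSearch.lastBelow j j

    bag-suc : ∀ j → bag (suc j) ≡ kept (suc j) ∪ ⁅ new (suc j) ⁆
    bag-suc j = refl

    host< : ∀ {j} → 0 < j → host j < j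
    host< {suc j} _ = HostSearch.lastBelow-suc< (suc j) j

    kept≡ : ∀ {j} → 0 < j → kept j ≡ bag (host j) - pick default (bag (host j)) (back j)
    kept≡ {j} 0<j = cong (λ S → S - pick default S (back j)) (earlier≡bag (host< 0<j))

    host-covers : ∀ {j i} → i < j → back j ⊆ bag i → back j ⊆ bag (host j)
    host-covers {j} i<j back⊆ x∈ = subst (_ ∈_) (earlier≡bag (host< (≤-trans (s≤s z≤n) i<j)))
      (HostSearch.lastBelow-satisfies j i<j (λ y∈ → subst (_ ∈_) (≡-sym (earlier≡bag i<j)) (back⊆ y∈)) x∈)

    parent≤ : ∀ j → parent j ≤ j
    parent≤ j = ParentSearch.lastBelow≤ j j

    parent< : ∀ {j} → 0 < j → parent j < j
    parent< {suc j} _ = ParentSearch.lastBelow-suc< (suc j) j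

    parent-covers : ∀ {j i} → i < j → kept j ⊆ bag i → kept j ⊆ bag (parent j)
    parent-covers {j} i<j kept⊆ x∈ = subst (_ ∈_) (earlier≡bag (parent< (≤-trans (s≤s z≤n) i<j)))
      (ParentSearch.lastBelow-satisfies j i<j (λ y∈ → subst (_ ∈_) (≡-sym (earlier≡bag i<j)) (kept⊆ y∈)) x∈)

    parent-maximal : ∀ {j i} → i < j → kept j ⊆ bag i → i ≤ parent j
    parent-maximal {j} i<j kept⊆ =
      ParentSearch.lastBelow-maximal j i<j (λ y∈ → subst (_ ∈_) (≡-sym (earlier≡bag i<j)) (kept⊆ y∈))

  bag≡kept∪new : ∀ {j} → 0 < j → bag j ≡ kept j ∪ ⁅ new j ⁆
  bag≡kept∪new {suc j} _ = bag-suc j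

  new∈bag : ∀ {j} → 0 < j → new j ∈ bag j
  new∈bag {j} 0<j = subst (new j ∈_) (≡-sym (bag≡kept∪new 0<j)) (x∈p∪q⁺ (inj₂ (x∈⁅x⁆ (new j))))

  kept⊆bag : ∀ {j} → 0 < j → kept j ⊆ bag j
  kept⊆bag {j} 0<j x∈ = subst (_ ∈_) (≡-sym (bag≡kept∪new 0<j)) (x∈p∪q⁺ (inj₁ x∈))

  ∈bag⁻ : ∀ {j x} → 0 < j → x ∈ bag j → x ∈ kept j ⊎ x ≡ new j
  ∈bag⁻ {j} 0<j x∈ with x∈p∪q⁻ (kept j) ⁅ new j ⁆ (subst (_ ∈_) (bag≡kept∪new 0<j) x∈)
  ... | inj₁ x∈kept = inj₁ x∈kept
  ... | inj₂ x∈new  = inj₂ (x∈⁅y⁆⇒x≡y (new j) x∈new)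

  record Attached (j : ℕ) : Set where
    field
      back⊆kept   : back j ⊆ kept j
      kept⊆parent : kept j ⊆ bag (parent j)
      ∣kept∣≡k′   : ∣ kept j ∣ ≡ k′
      new∉parent  : new j ∉ bag (parent j)

  record Invariant (j : ℕ) : Set where
    field
      ∣bag∣≡k  : ∣ bag j ∣ ≡ k
      rank≤    : ∀ {x} → x ∈ bag j → rank x ≤ k′ + j
      attached : 0 < j → Attached j
  open Attached
  open Invariant

  back⊆bag : ∀ {j} → 0 < j → Attached j → back j ⊆ bag j
  back⊆bag 0<j A x∈ = kept⊆bag 0<j (back⊆kept A x∈)

  ∣initial∣≡k : ∣ initial ∣ ≡ k
  ∣initial∣≡k = ≤-antisym ∣initial∣≤k (injection⇒≤∣ initial ∣ (λ i → vertexAt (toℕ i)) at-injective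
    λ i → ∈initial⁺ (subst (_≤ k′) (≡-sym (rank-vertexAt (<k⇒<N i))) (≤-pred (toℕ<n i))))
    where
    <k⇒<N : ∀ (i : Fin k) → toℕ i < N
    <k⇒<N i = ≤-trans (toℕ<n i) (subst (k ≤_) k+m≡N (m≤m+n k m))
    at-injective : ∀ {i j : Fin k} → vertexAt (toℕ i) ≡ vertexAt (toℕ j) → i ≡ j
    at-injective {i} {j} e = toℕ-injective
      (trans (≡-sym (rank-vertexAt (<k⇒<N i))) (trans (cong rank e) (rank-vertexAt (<k⇒<N j))))
    above : ∀ (i : Fin m) → k + toℕ i < N
    above i = subst (k + toℕ i <_) k+m≡N (+-monoʳ-< k (toℕ<n i))
    m≤∣∁initial∣ : m ≤ ∣ ∁ initial ∣
    m≤∣∁initial∣ = injection⇒≤∣ ∁ initial ∣ (λ i → vertexAt (k + toℕ i))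
      (λ {i} {j} e → toℕ-injective (+-cancelˡ-≡ k _ _
        (trans (≡-sym (rank-vertexAt (above i))) (trans (cong rank e) (rank-vertexAt (above j))))))
      λ i → x∉p⇒x∈∁p λ x∈ → 1+n≰n (≤-trans (subst (k ≤_) (≡-sym (rank-vertexAt (above i))) (m≤m+n k (toℕ i)))
                                            (∈initial⁻ x∈))
    ∣initial∣≤k : ∣ initial ∣ ≤ k
    ∣initial∣≤k = ∸-cancelʳ-≤ (∣p∣≤n initial)
      (subst (λ z → z ∸ k ≤ n F ∸ ∣ initial ∣) N≡n (subst (m ≤_) (∣∁p∣≡n∸∣p∣ initial) m≤∣∁initial∣))

  data Introduction (x : V F) : Set where
    initially : rank x ≤ k′ → Introduction x
    at        : ∀ j → 0 < j → j ≤ m → new j ≡ x → Introduction x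

  introduction : ∀ x → Introduction x
  introduction x with rank x ≤? k′
  ... | yes r≤k′ = initially r≤k′
  ... | no  r≰k′ = at (rank x ∸ k′) (m<n⇒0<n∸m k′<r) j≤m (trans (cong vertexAt k′+j≡r) (vertexAt-rank x))
    where
    k′<r : k′ < rank x
    k′<r = ≰⇒> r≰k′
    k′+j≡r : k′ + (rank x ∸ k′) ≡ rank x
    k′+j≡r = m+[n∸m]≡n (<⇒≤ k′<r)
    j≤m : rank x ∸ k′ ≤ m
    j≤m = +-cancelˡ-≤ k′ _ _ (≤-pred (subst₂ _<_ (≡-sym k′+j≡r) (≡-sym k+m≡N) (rank<N x)))

  initially∈bag : ∀ {x} → rank x ≤ k′ → x ∈ bag 0
  initially∈bag r≤k′ = subst (_ ∈_) (≡-sym bag-zero) (∈initial⁺ r≤k′)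

  ∈bag0⇒initially : ∀ {x} → x ∈ bag 0 → rank x ≤ k′
  ∈bag0⇒initially x∈ = ∈initial⁻ (subst (_ ∈_) bag-zero x∈)

  new-later : ∀ {j} → 0 < j → j ≤ m → k′ < rank (new j)
  new-later {j} 0<j j≤m = subst (k′ <_) (≡-sym (rank-new j≤m)) (m<m+n k′ 0<j)

  earlier-in-top-bag : ∀ {j x} → j ≤ m → x ∈ β D (top (new j)) → rank x < rank (new j) → x ∈ back j
  earlier-in-top-bag {j} j≤m x∈ r< = ∈back⁺ x∈ (subst (_ <_) (rank-new j≤m) r<)

  back-covered : ∀ {j} → 0 < j → j ≤ m → (∀ {i} → i < j → 0 < i → Attached i) →
                 ∃ λ i → i < j × back j ⊆ bag i
  back-covered {j} 0<j j≤m attached-below with any? (λ x → x ∈? back j)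
  ... | no  ∄x = 0 , 0<j , λ x∈ → ⊥-elim (∄x (_ , x∈))
  ... | yes ∃x with argmaxOn rank (λ x → x ∈? back j) ∃x
  ...   | w , w∈ , w-last with introduction w
  ...     | initially r≤k′ = 0 , 0<j , λ x∈ → initially∈bag (≤-trans (w-last _ x∈) r≤k′)
  ...     | at i 0<i i≤m refl = i , i<j , λ {x} x∈ → covered x∈
    where
    i<j : i < j
    i<j = +-cancelˡ-< k′ i j (subst (_< k′ + j) (rank-new i≤m) (proj₂ (∈back⁻ w∈)))
    covered : ∀ {x} → x ∈ back j → x ∈ bag i
    covered {x} x∈ with x ≟ᶠ new i
    ... | yes refl = new∈bag 0<i
    ... | no x≢w = back⊆bag 0<i (attached-below i<j 0<i) (earlier-in-top-bag i≤m
      (∈-top-of-deeper (proj₁ (∈back⁻ x∈)) (proj₁ (∈back⁻ w∈)) (topDepth-monotone (<⇒≤ x<w))) x<w)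
      where
      x<w : rank x < rank (new i)
      x<w = ≤∧≢⇒< (w-last x x∈) (λ e → x≢w (rank-injective e))

  module Step {j} (0<j : 0 < j) (j≤m : j ≤ m) (below : ∀ {i} → i < j → Invariant i) where

    back⊆host : back j ⊆ bag (host j)
    back⊆host with back-covered 0<j j≤m (λ i<j → attached (below i<j))
    ... | i , i<j , back⊆bag-i = host-covers i<j back⊆bag-i

    ∣host∣≡k : ∣ bag (host j) ∣ ≡ k
    ∣host∣≡k = ∣bag∣≡k (below (host< 0<j))

    ∣back∣<k : ∣ back j ∣ < k
    ∣back∣<k = ≤-trans (p⊂q⇒∣p∣<∣q∣ ((λ x∈ → proj₁ (∈back⁻ x∈)) , new j , VertexTop.Q-top (new j) , new∉back))
                       (∣β∣≤k _)
      where
      new∉back : new j ∉ back j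
      new∉back x∈ = <-irrefl (rank-new j≤m) (proj₂ (∈back⁻ x∈))

    removed : V F
    removed = pick default (bag (host j)) (back j)

    removed∈∖back : removed ∈ bag (host j) × removed ∉ back j
    removed∈∖back = pick∈∖ default (subst (∣ back j ∣ <_) (≡-sym ∣host∣≡k) ∣back∣<k)

    ∈kept⁻ : ∀ {x} → x ∈ kept j → x ∈ bag (host j) × x ≢ removed
    ∈kept⁻ x∈ = let x∈′ = subst (_ ∈_) (kept≡ 0<j) x∈ in x∈p-y⇒x∈p x∈′ , x∈p-y⇒x≢y x∈′

    kept⊇back : back j ⊆ kept j
    kept⊇back x∈ = subst (_ ∈_) (≡-sym (kept≡ 0<j))
      (x∈p∧x≢y⇒x∈p-y (back⊆host x∈) λ { refl → proj₂ removed∈∖back x∈ })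

    kept-size : ∣ kept j ∣ ≡ k′
    kept-size = suc-injective (trans (cong (λ S → suc ∣ S ∣) (kept≡ 0<j))
      (trans (x∈p⇒suc∣p-x∣≡∣p∣ (proj₁ removed∈∖back)) ∣host∣≡k))

    rank≤host : ∀ {x} → x ∈ bag (host j) → rank x < rank (new j)
    rank≤host x∈ = ≤-trans (s≤s (rank≤ (below (host< 0<j)) x∈))
      (subst (k′ + host j <_) (≡-sym (rank-new j≤m)) (+-monoʳ-< k′ (host< 0<j)))

    new∉kept : new j ∉ kept j
    new∉kept x∈ = <-irrefl refl (rank≤host (proj₁ (∈kept⁻ x∈)))

    invariant-step : Invariant j
    invariant-step = record
      { ∣bag∣≡k  = trans (cong ∣_∣ (bag≡kept∪new 0<j)) (trans (x∉p⇒∣p∪⁅x⁆∣≡suc∣p∣ new∉kept) (cong suc kept-size))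
      ; rank≤    = λ x∈ → [ (λ x∈kept → <⇒≤ (subst (_ <_) (rank-new j≤m) (rank≤host (proj₁ (∈kept⁻ x∈kept)))))
                          , (λ { refl → ≤-reflexive (rank-new j≤m) }) ] (∈bag⁻ 0<j x∈)
      ; attached = λ _ → record
        { back⊆kept   = kept⊇back
        ; kept⊆parent = parent-covers (host< 0<j) (λ x∈ → proj₁ (∈kept⁻ x∈))
        ; ∣kept∣≡k′   = kept-size
        ; new∉parent  = λ x∈ → <-irrefl (rank-new j≤m)
            (≤-trans (s≤s (rank≤ (below (parent< 0<j)) x∈)) (+-monoʳ-< k′ (parent< 0<j)))
        }
      }


  invariant-zero : Invariant 0
  invariant-zero = record
      { ∣bag∣≡k  = trans (cong ∣_∣ bag-zero) ∣initial∣≡k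
      ; rank≤    = λ {x} x∈ → subst (rank x ≤_) (≡-sym (+-identityʳ k′)) (∈bag0⇒initially x∈)
      ; attached = λ () }

  invariant : ∀ {j} → j ≤ m → Invariant j
  invariant {j} = <-rec (λ j → j ≤ m → Invariant j) build j
    where
    build : ∀ j → (∀ {i} → i < j → i ≤ m → Invariant i) → j ≤ m → Invariant j
    build zero    _     _   = invariant-zero
    build (suc j) below j≤m = Step.invariant-step {suc j} (s≤s z≤n) j≤m (λ i<j → below i<j (≤-trans (<⇒≤ i<j) j≤m))

  attachment : ∀ {j} → 0 < j → j ≤ m → Attached j
  attachment 0<j j≤m = attached (invariant j≤m) 0<j

  homeOf : ∀ {x} → Introduction x → ℕ
  homeOf (initially _) = 0
  homeOf (at j _ _ _)  = j

  home : V F → ℕ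
  home x = homeOf (introduction x)

  home≤m : ∀ x → home x ≤ m
  home≤m x with introduction x
  ... | initially _    = z≤n
  ... | at _ _ j≤m _   = j≤m

  ∈bag-home : ∀ x → x ∈ bag (home x)
  ∈bag-home x with introduction x
  ... | initially r≤k′   = initially∈bag r≤k′
  ... | at _ 0<j _ refl  = new∈bag 0<j

  home-new : ∀ {j} → 0 < j → j ≤ m → home (new j) ≡ j
  home-new {j} 0<j j≤m with introduction (new j)
  ... | initially r≤k′    = ⊥-elim (<⇒≱ (new-later 0<j j≤m) r≤k′)
  ... | at i _ i≤m new≡   = +-cancelˡ-≡ k′ i j (trans (≡-sym (rank-new i≤m)) (trans (cong rank new≡) (rank-new j≤m)))

  leave-home : ∀ {x j} → x ∈ bag j → j ≤ m → j ≢ home x → 0 < j × x ∈ bag (parent j)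
  leave-home {x} {zero} x∈ _ 0≢home with introduction x
  ... | initially _      = ⊥-elim (0≢home refl)
  ... | at _ 0<i i≤m refl = ⊥-elim (<⇒≱ (new-later 0<i i≤m) (∈bag0⇒initially x∈))
  leave-home {x} {suc j} x∈ j≤m j≢home with ∈bag⁻ (s≤s z≤n) x∈
  ... | inj₁ x∈kept = s≤s z≤n , kept⊆parent (attachment (s≤s z≤n) j≤m) x∈kept
  ... | inj₂ refl   = ⊥-elim (j≢home (≡-sym (home-new (s≤s z≤n) j≤m)))

  bag-parent∩bag≡kept : ∀ {j} → 0 < j → j ≤ m → ∣ bag (parent j) ∩ bag j ∣ ≡ k′
  bag-parent∩bag≡kept {j} 0<j j≤m = trans (≤-antisym (p⊆q⇒∣p∣≤∣q∣ ∩⊆kept) (p⊆q⇒∣p∣≤∣q∣ kept⊆∩)) (∣kept∣≡k′ A)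
    where
    A = attachment 0<j j≤m
    ∩⊆kept : bag (parent j) ∩ bag j ⊆ kept j
    ∩⊆kept x∈ with x∈p∩q⁻ (bag (parent j)) (bag j) x∈
    ... | x∈parent , x∈bag with ∈bag⁻ 0<j x∈bag
    ...   | inj₁ x∈kept = x∈kept
    ...   | inj₂ refl   = ⊥-elim (new∉parent A x∈parent)
    kept⊆∩ : kept j ⊆ bag (parent j) ∩ bag j
    kept⊆∩ x∈ = x∈p∩q⁺ (kept⊆parent A x∈ , kept⊆bag 0<j x∈)

  siblings-miss-distinct : ∀ {i j} → 0 < i → i < j → j ≤ m → parent i ≡ parent j →
                           ∀ {y} → y ∈ bag (parent i) → y ∉ kept i → y ∉ kept j → ⊥
  siblings-miss-distinct {i} {j} 0<i i<j j≤m same {y} y∈ y∉i y∉j =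
    <⇒≱ (parent< 0<i) (subst (i ≤_) (≡-sym same) (parent-maximal i<j (λ x∈ → kept⊆bag 0<i (kept-j⊆kept-i x∈))))
    where
    Ai = attachment 0<i (≤-trans (<⇒≤ i<j) j≤m)
    Aj = attachment (≤-trans 0<i (<⇒≤ i<j)) j≤m
    kept-j⊆kept-i : kept j ⊆ kept i
    kept-j⊆kept-i = ⊆-by-size (kept⊆parent Ai) y∉i
      (trans (cong suc (∣kept∣≡k′ Ai)) (≡-sym (∣bag∣≡k (invariant (≤-trans (parent≤ i) (≤-trans (<⇒≤ i<j) j≤m))))))
      (subst (λ p → kept j ⊆ bag p) (≡-sym same) (kept⊆parent Aj)) y∉j y∈

  toℕ≤m : ∀ (t : Fin (suc m)) → toℕ t ≤ m
  toℕ≤m t = ≤-pred (toℕ<n t)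

  nonzero⇒0< : ∀ {t : Fin (suc m)} → t ≢ fzero → 0 < toℕ t
  nonzero⇒0< {fzero}  t≢0 = ⊥-elim (t≢0 refl)
  nonzero⇒0< {fsuc _} _   = s≤s z≤n

  parentᶠ : Fin (suc m) → Fin (suc m)
  parentᶠ t = fromℕ< (s≤s (≤-trans (parent≤ (toℕ t)) (toℕ≤m t)))

  toℕ-parentᶠ : ∀ t → toℕ (parentᶠ t) ≡ parent (toℕ t)
  toℕ-parentᶠ t = toℕ-fromℕ< _

  parentᶠ< : ∀ {t} → t ≢ fzero → toℕ (parentᶠ t) < toℕ t
  parentᶠ< {t} t≢0 = subst (_< toℕ t) (≡-sym (toℕ-parentᶠ t)) (parent< (nonzero⇒0< t≢0))

  open ParentTree m parentᶠ parentᶠ<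

  bagᶠ : Fin (suc m) → Subset (n F)
  bagᶠ t = bag (toℕ t)

  ∈bagᶠ : ∀ {x j} (j≤m : j ≤ m) → x ∈ bag j → x ∈ bagᶠ (fromℕ< (s≤s j≤m))
  ∈bagᶠ {x} j≤m x∈ = subst (λ i → x ∈ bag i) (≡-sym (toℕ-fromℕ< _)) x∈

  homeᶠ : V F → Fin (suc m)
  homeᶠ x = fromℕ< (s≤s (home≤m x))

  later-endpoint-bag : ∀ {a b t} → rank a < rank b → a ∈ β D t → b ∈ β D t → ∃[ s ] (a ∈ bagᶠ s × b ∈ bagᶠ s)
  later-endpoint-bag {a} {b} a<b a∈ b∈ with introduction b
  ... | initially b≤k′ = fzero , initially∈bag (≤-trans (<⇒≤ a<b) b≤k′) , initially∈bag b≤k′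
  ... | at j 0<j j≤m refl = fromℕ< (s≤s j≤m) , ∈bagᶠ j≤m a∈bag , ∈bagᶠ j≤m (new∈bag 0<j)
    where
    a∈bag : a ∈ bag j
    a∈bag = back⊆bag 0<j (attachment 0<j j≤m)
      (earlier-in-top-bag j≤m (∈-top-of-deeper a∈ b∈ (topDepth-monotone (<⇒≤ a<b))) a<b)

  edge-in-bag : ∀ a b → Adj F a b → ∃[ s ] (a ∈ bagᶠ s × b ∈ bagᶠ s)
  edge-in-bag a b ab with edge D a b ab
  ... | t , a∈ , b∈ with <-cmp (rank a) (rank b)
  ...   | tri< a<b _ _ = later-endpoint-bag a<b a∈ b∈
  ...   | tri≈ _ a≡b _ = ⊥-elim (irrefl F (subst (Adj F a) (≡-sym (rank-injective a≡b)) ab))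
  ...   | tri> _ _ b<a with later-endpoint-bag b<a b∈ a∈
  ...     | s , b∈s , a∈s = s , a∈s , b∈s

  bags-containing-connected : ∀ x s t → x ∈ bagᶠ s → x ∈ bagᶠ t →
                              Σ (Walk tree s t) λ p → All (λ y → x ∈ bagᶠ y) (verts p)
  bags-containing-connected x = upward-closed⇒connected (λ y → x ∈ bagᶠ y) (homeᶠ x) up
    where
    up : ∀ {j} → x ∈ bagᶠ j → j ≢ homeᶠ x → j ≢ fzero × x ∈ bagᶠ (parentᶠ j)
    up {j} x∈ j≢home with leave-home x∈ (toℕ≤m j) (λ e → j≢home (toℕ-injective (trans e (≡-sym (toℕ-fromℕ< _)))))
    ... | 0<j , x∈parent = (λ { refl → <-irrefl refl 0<j }) , subst (λ i → x ∈ bag i) (≡-sym (toℕ-parentᶠ j)) x∈parent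

  decomposition : TreeDecomposition F
  decomposition = record
    { T        = tree
    ; isTree   = tree-isTree
    ; β        = bagᶠ
    ; cover    = λ x → homeᶠ x , ∈bagᶠ (home≤m x) (∈bag-home x)
    ; edge     = edge-in-bag
    ; coherent = bags-containing-connected
    }

  ∣bagᶠ∣≡k : ∀ t → ∣ bagᶠ t ∣ ≡ k
  ∣bagᶠ∣≡k t = ∣bag∣≡k (invariant (toℕ≤m t))

  below-parent : ∀ {s t} → t ≢ fzero → parentᶠ t ≡ s → ∣ bagᶠ s ∩ bagᶠ t ∣ ≡ k′
  below-parent {s} {t} t≢0 refl =
    subst (λ p → ∣ bag p ∩ bagᶠ t ∣ ≡ k′) (≡-sym (toℕ-parentᶠ t)) (bag-parent∩bag≡kept (nonzero⇒0< t≢0) (toℕ≤m t))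

  adjacent-bags : ∀ s t → ParentEdge s t → ∣ bagᶠ s ∩ bagᶠ t ∣ ≡ k′
  adjacent-bags s t (inj₁ (t≢0 , pt≡s)) = below-parent t≢0 pt≡s
  adjacent-bags s t (inj₂ (s≢0 , ps≡t)) = trans (cong ∣_∣ (∩-comm (bagᶠ s) (bagᶠ t))) (below-parent s≢0 ps≡t)

  at-most-k-children : ∀ t → OutDegAtMost tree fzero k t
  at-most-k-children t c c-injective c-child =
    1+n≰n (subst (suc k ≤_) (∣bagᶠ∣≡k t)
      (injection⇒≤∣ bagᶠ t ∣ missing missing-injective (λ i → proj₁ (missing∈∖ i))))
    where
    idx : Fin (suc k) → ℕ
    idx i = toℕ (c i)
    0<idx : ∀ i → 0 < idx i
    0<idx i = nonzero⇒0< (proj₁ (child⇒parent (c-child i)))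
    parent-idx : ∀ i → parent (idx i) ≡ toℕ t
    parent-idx i = trans (≡-sym (toℕ-parentᶠ (c i))) (cong toℕ (proj₂ (child⇒parent (c-child i))))
    missing : Fin (suc k) → V F
    missing i = pick default (bagᶠ t) (kept (idx i))
    missing∈∖ : ∀ i → missing i ∈ bagᶠ t × missing i ∉ kept (idx i)
    missing∈∖ i = pick∈∖ default (subst (_< ∣ bagᶠ t ∣) (≡-sym (∣kept∣≡k′ (attachment (0<idx i) (toℕ≤m (c i)))))
                                        (≤-reflexive (≡-sym (∣bagᶠ∣≡k t))))
    ordered : ∀ {i i′} → idx i < idx i′ → missing i ≢ missing i′
    ordered {i} {i′} i<i′ same = siblings-miss-distinct (0<idx i) i<i′ (toℕ≤m (c i′))
      (trans (parent-idx i) (≡-sym (parent-idx i′)))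
      (subst (λ p → missing i ∈ bag p) (≡-sym (parent-idx i)) (proj₁ (missing∈∖ i)))
      (proj₂ (missing∈∖ i)) (subst (_∉ kept (idx i′)) (≡-sym same) (proj₂ (missing∈∖ i′)))
    missing-injective : ∀ {i i′} → missing i ≡ missing i′ → i ≡ i′
    missing-injective {i} {i′} same with <-cmp (idx i) (idx i′)
    ... | tri< i<i′ _ _ = ⊥-elim (ordered i<i′ same)
    ... | tri≈ _ i≡i′ _ = c-injective (toℕ-injective i≡i′)
    ... | tri> _ _ i′<i = ⊥-elim (ordered i′<i (≡-sym same))

lemma8 : ∀ (k : ℕ) → 1 ≤ k → (F : Graph) → TwAtMost F (k ∸ 1) → k ≤ n F →
         Σ (TreeDecomposition F) λ D →
           (∀ t → ∣ β D t ∣ ≡ k) ×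
           (∀ s t → Adj (T D) s t → ∣ β D s ∩ β D t ∣ ≡ k ∸ 1) ×
           (∃[ r ] (∀ t → OutDegAtMost (T D) r k t))
lemma8 (suc k′) _ F (D , width≤) k≤n =
  decomposition , ∣bagᶠ∣≡k , adjacent-bags , fzero , at-most-k-children
  where open Construction k′ F D width≤ k≤n
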